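{- Let $d\ge0$ and $\alpha\in\tilde{A}_d$, written as $\alpha=1B_12B_2\ldots kB_k$ with $k=\max\alpha$ and each factor $iB_i$ decreasing with pace $d$. Then $\alpha$ avoids both patterns $112$ and $213$ if and only if $B_1=B_2=\dots=B_{k-1}=\emptyset$.
   Context: All sequences are finite words $\alpha=a_1\ldots a_n$ of positive integers. For an integer $d\ge 0$, an index $i\in[n]$ is a $d$-ascent of $\alpha$ if $i=1$, or $i\ge 2$ and $a_i>a_{i-1}-d$; $\mathrm{asc}_d\alpha$ is the number of $d$-ascents. $\alpha$ is a $d$-ascent sequence if $a_i\le1+\mathrm{asc}_d(a_1\ldots a_{i-1})$ for all $i$; $A_d$ is the set of these. For a word $\alpha$ and index $j$, $M(\alpha,j)$ adds $1$ to every $a_i$ with $i<j$ and $a_i\ge a_j$; $M(\alpha,j_1,\dots,j_k)=M(M(\alpha,j_1,\dots,j_{k-1}),j_k)$; $\mathrm{hat}_d(\alpha)=M(\alpha,j_1,\dots,j_k)$ with $j_1<\dots<j_k$ the $d$-ascents of $\alpha$. $\tilde{A}_d=\{\alpha\in A_d:\mathrm{hat}_d(\alpha)=\alpha\}$; every element of $\tilde A_d$ admits a factorization $1B_12B_2\ldots kB_k$ as in the claim (the $B_i$ possibly empty words). A word $c_1\ldots c_\ell$ is decreasing with pace $d$ if $c_j-c_{j+1}\ge d$ for $1\le j<\ell$. A word contains a pattern $p$ if it has a subsequence order-isomorphic to $p$ (same relative order, including equalities); otherwise it avoids $p$. -}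

module Defs where

open import Data.Nat using (ℕ; zero; suc; _+_; _∸_; _≤_; _<_; _≤ᵇ_; _<ᵇ_; _⊔_)
open import Data.Bool using (Bool; true; false; if_then_else_)
open import Data.List using (List; []; _∷_; _++_; map; take; drop; length; upTo; filterᵇ; foldl; foldr)
open import Data.List.Relation.Unary.All using (All)
open import Data.List.Relation.Binary.Sublist.Propositional using (_⊆_)
open import Data.Product using (Σ; _×_)
open import Data.Unit using (⊤)
open import Data.Fin using (Fin; toℕ)
open import Function.Bundles using (_⇔_)
open import Relation.Binary.PropositionalEquality using (_≡_)
open import Relation.Nullary using (¬_)

-- Words are lists of naturals; indices are 0-based internally
-- (index i here corresponds to index i+1 in the paper).

-- entry at index i (default 0 outside the word; only used in range)
at : List ℕ → ℕ → ℕ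
at []       _       = 0
at (x ∷ xs) zero    = x
at (x ∷ xs) (suc i) = at xs i

-- index i is a d-ascent: i is the first index, or a_i > a_{i-1} - d,
-- i.e. (over ℕ) a_{i-1} < a_i + d
isDAscentᵇ : ℕ → List ℕ → ℕ → Bool
isDAscentᵇ d α zero    = true
isDAscentᵇ d α (suc i) = at α i <ᵇ at α (suc i) + d

dAscents : ℕ → List ℕ → List ℕ
dAscents d α = filterᵇ (isDAscentᵇ d α) (upTo (length α))

asc : ℕ → List ℕ → ℕ
asc d α = length (dAscents d α)

IsDAscentSeq : ℕ → List ℕ → Set
IsDAscentSeq d α =
  All (1 ≤_) α ×
  ((i : Fin (length α)) → at α (toℕ i) ≤ suc (asc d (take (toℕ i) α)))

M : List ℕ → ℕ → List ℕ
M α j = map (λ a → if at α j ≤ᵇ a then suc a else a) (take j α) ++ drop j α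

hat : ℕ → List ℕ → List ℕ
hat d α = foldl M α (dAscents d α)

InÃ : ℕ → List ℕ → Set
InÃ d α = IsDAscentSeq d α × hat d α ≡ α

data DecPace (d : ℕ) : List ℕ → Set where
  dp[]  : DecPace d []
  dp[_] : ∀ x → DecPace d (x ∷ [])
  dp∷   : ∀ {x y r} → y + d ≤ x → DecPace d (y ∷ r) → DecPace d (x ∷ y ∷ r)

factors : ℕ → List (List ℕ) → List (List ℕ)
factors i []       = []
factors i (B ∷ Bs) = (i ∷ B) ∷ factors (suc i) Bs

concatL : List (List ℕ) → List ℕ
concatL = foldr _++_ []

-- max α (0 for the empty word)
maxW : List ℕ → ℕ
maxW = foldr _⊔_ 0

OrderIso : List ℕ → List ℕ → Set
OrderIso σ p = length σ ≡ length p ×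
  (∀ i j → i < length p → j < length p →
     ((at σ i < at σ j) ⇔ (at p i < at p j)) ×
     ((at σ i ≡ at σ j) ⇔ (at p i ≡ at p j)))

Contains : List ℕ → List ℕ → Set
Contains α p = Σ (List ℕ) λ σ → (σ ⊆ α) × OrderIso σ p

Avoids : List ℕ → List ℕ → Set
Avoids α p = ¬ Contains α p

-- If some inner block B_i (i < k) is nonempty, its first letter b satisfies 1 ≤ b ≤ i
-- because i B_i decreases; so b already occurs among the heads 1, …, i, and the head
-- i+1 of the next factor completes an occurrence b b (i+1) of 112.
-- Conversely, if only B_k may be nonempty, α is the increasing word 1 2 … (k-1) followed
-- by the nonincreasing word k B_k. The smaller letter y of a rise y < z then lies in the
-- increasing part, so every letter before y is smaller than y, whereas both 112 and 213
-- put a letter x ≥ y before such a y.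

module Submission where

open import Defs
open import Data.Nat using (ℕ; suc; _∸_; _≤_; _<_; _≥_; s≤s; z<s; s<s)
open import Data.Nat.Properties
  using (≤-refl; ≤-trans; m≤m+n; m≤n⇒m<n∨m≡n; n≮n; <-asym; <⇒≢; >⇒≢; <⇒≤; ≤⇒≯; ≤-reflexive)
open import Data.List using (List; []; _∷_; _++_; length; take)
open import Data.List.Properties using (∷ʳ-++; ++-identityʳ)
open import Data.List.Membership.Propositional using (_∈_)
open import Data.List.Membership.Propositional.Properties using (∈-++⁺ˡ; ∈-++⁺ʳ)
open import Data.List.Relation.Unary.Any using (here; there)
open import Data.List.Relation.Unary.All as All using (All; []; _∷_)
open import Data.List.Relation.Unary.AllPairs using (AllPairs; []; _∷_)
open import Data.List.Relation.Unary.Linked using (Linked; []; [-]; _∷_)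
open import Data.List.Relation.Unary.Linked.Properties using (Linked⇒AllPairs)
open import Data.List.Relation.Binary.Sublist.Propositional using (_⊆_; []; _∷_; _∷ʳ_; minimum; from∈)
open import Data.List.Relation.Binary.Sublist.Propositional.Properties using (All-resp-⊆; ∷ˡ⁻; ++⁺; ++⁺ˡ)
open import Data.Product using (_×_; _,_; proj₁; proj₂; ∃₂)
open import Data.Sum using (inj₁; inj₂)
open import Data.Empty using (⊥-elim)
open import Function using (flip; _∘′_)
open import Function.Bundles using (_⇔_; mk⇔; Equivalence)
open import Relation.Binary.PropositionalEquality using (_≡_; refl; sym; subst; cong)
open import Relation.Nullary using (¬_)

private
  variable
    d m x y z a b c : ℕ
    xs X U D : List ℕ

DecPace⇒nonincreasing : DecPace d xs → Linked _≥_ xs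
DecPace⇒nonincreasing dp[]       = []
DecPace⇒nonincreasing dp[ _ ]    = [-]
DecPace⇒nonincreasing (dp∷ h dp) = ≤-trans (m≤m+n _ _) h ∷ DecPace⇒nonincreasing dp

AllPairs-resp-⊆ : {R : ℕ → ℕ → Set} → xs ⊆ X → AllPairs R X → AllPairs R xs
AllPairs-resp-⊆ (_ ∷ʳ s)    (_ ∷ ps)  = AllPairs-resp-⊆ s ps
AllPairs-resp-⊆ (refl ∷ s)  (p ∷ ps)  = All-resp-⊆ s p ∷ AllPairs-resp-⊆ s ps
AllPairs-resp-⊆ []          []        = []

Agree : ℕ → ℕ → ℕ → ℕ → Set
Agree x y a b = ((x < y) ⇔ (a < b)) × ((x ≡ y) ⇔ (a ≡ b))

agree-refl : Agree x x a a
agree-refl {x} {a} = mk⇔ (⊥-elim ∘′ n≮n x) (⊥-elim ∘′ n≮n a) , mk⇔ (λ _ → refl) (λ _ → refl)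

<-agree : x < y → a < b → Agree x y a b
<-agree x<y a<b = mk⇔ (λ _ → a<b) (λ _ → x<y) , mk⇔ (⊥-elim ∘′ <⇒≢ x<y) (⊥-elim ∘′ <⇒≢ a<b)

>-agree : y < x → b < a → Agree x y a b
>-agree y<x b<a =
  mk⇔ (⊥-elim ∘′ <-asym y<x) (⊥-elim ∘′ <-asym b<a) , mk⇔ (⊥-elim ∘′ >⇒≢ y<x) (⊥-elim ∘′ >⇒≢ b<a)

112-iso : ∀ {b c} → b < c → OrderIso (b ∷ b ∷ c ∷ []) (1 ∷ 1 ∷ 2 ∷ [])
112-iso {b} {c} b<c = refl , agree
  where
  agree : ∀ i j → i < 3 → j < 3 →
    Agree (at (b ∷ b ∷ c ∷ []) i) (at (b ∷ b ∷ c ∷ []) j) (at (1 ∷ 1 ∷ 2 ∷ []) i) (at (1 ∷ 1 ∷ 2 ∷ []) j)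
  agree 0 0 _ _ = agree-refl
  agree 0 1 _ _ = agree-refl
  agree 0 2 _ _ = <-agree b<c (s<s z<s)
  agree 1 0 _ _ = agree-refl
  agree 1 1 _ _ = agree-refl
  agree 1 2 _ _ = <-agree b<c (s<s z<s)
  agree 2 0 _ _ = >-agree b<c (s<s z<s)
  agree 2 1 _ _ = >-agree b<c (s<s z<s)
  agree 2 2 _ _ = agree-refl
  agree (suc (suc (suc _))) _ (s<s (s<s (s<s ()))) _
  agree _ (suc (suc (suc _))) _ (s<s (s<s (s<s ())))

112-shape : OrderIso (x ∷ y ∷ z ∷ []) (1 ∷ 1 ∷ 2 ∷ []) → y ≤ x × y < z
112-shape (_ , agree) =
  ≤-reflexive (sym (Equivalence.from (proj₂ (agree 0 1 z<s (s<s z<s))) refl)) ,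
  Equivalence.from (proj₁ (agree 1 2 (s<s z<s) (s<s (s<s z<s)))) (s<s z<s)

213-shape : OrderIso (x ∷ y ∷ z ∷ []) (2 ∷ 1 ∷ 3 ∷ []) → y ≤ x × y < z
213-shape (_ , agree) =
  <⇒≤ (Equivalence.from (proj₁ (agree 1 0 (s<s z<s) z<s)) (s<s z<s)) ,
  Equivalence.from (proj₁ (agree 1 2 (s<s z<s) (s<s (s<s z<s)))) (s<s z<s)

SmallerBeforeRise : List ℕ → Set
SmallerBeforeRise w = ∀ {x y z} → (x ∷ y ∷ z ∷ []) ⊆ w → y < z → x < y

SmallerBeforeRise⇒avoids : ∀ {w} → SmallerBeforeRise w →
  (∀ {x y z} → OrderIso (x ∷ y ∷ z ∷ []) (a ∷ b ∷ c ∷ []) → y ≤ x × y < z) →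
  Avoids w (a ∷ b ∷ c ∷ [])
SmallerBeforeRise⇒avoids smaller shape (x ∷ y ∷ z ∷ [] , sub , iso) with shape iso
... | y≤x , y<z = ≤⇒≯ y≤x (smaller sub y<z)

nonincreasing-has-no-rise : AllPairs _≥_ D → (y ∷ z ∷ []) ⊆ D → ¬ y < z
nonincreasing-has-no-rise ninc sub with AllPairs-resp-⊆ sub ninc
... | (z≤y ∷ []) ∷ _ = ≤⇒≯ z≤y

rise-starts-in-prefix : AllPairs _≥_ D → (y ∷ z ∷ []) ⊆ U ++ D → y < z → y ∈ U
rise-starts-in-prefix {U = []}    ninc sub          y<z = ⊥-elim (nonincreasing-has-no-rise ninc sub y<z)
rise-starts-in-prefix {U = u ∷ U} ninc (.u ∷ʳ sub)  y<z = there (rise-starts-in-prefix ninc sub y<z)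
rise-starts-in-prefix {U = u ∷ U} ninc (refl ∷ sub) y<z = here refl

increasing++nonincreasing⇒smallerBeforeRise :
  AllPairs _<_ U → AllPairs _≥_ D → SmallerBeforeRise (U ++ D)
increasing++nonincreasing⇒smallerBeforeRise {[]} inc ninc sub y<z =
  ⊥-elim (nonincreasing-has-no-rise ninc (∷ˡ⁻ sub) y<z)
increasing++nonincreasing⇒smallerBeforeRise {u ∷ U} (_ ∷ inc) ninc (.u ∷ʳ sub) y<z =
  increasing++nonincreasing⇒smallerBeforeRise inc ninc sub y<z
increasing++nonincreasing⇒smallerBeforeRise {u ∷ U} (u<U ∷ _) ninc (refl ∷ sub) y<z =
  All.lookup u<U (rise-starts-in-prefix ninc sub y<z)

InnerBlocksEmpty : List (List ℕ) → Set
InnerBlocksEmpty Bs = All (_≡ []) (take (length Bs ∸ 1) Bs)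

innerBlocksEmpty⇒increasing++nonincreasing : ∀ n Bs →
  InnerBlocksEmpty Bs → All (DecPace d) (factors n Bs) →
  ∃₂ λ U D → concatL (factors n Bs) ≡ U ++ D × AllPairs _<_ U × All (n ≤_) U × AllPairs _≥_ D
innerBlocksEmpty⇒increasing++nonincreasing n []            _          _        = [] , [] , refl , [] , [] , []
innerBlocksEmpty⇒increasing++nonincreasing n (B ∷ [])      _          (dp ∷ _) =
  [] , n ∷ B , cong (n ∷_) (++-identityʳ B) , [] , [] ,
  Linked⇒AllPairs (flip ≤-trans) (DecPace⇒nonincreasing dp)
innerBlocksEmpty⇒increasing++nonincreasing n ([] ∷ C ∷ Bs) (refl ∷ h) (_ ∷ dp)
  with innerBlocksEmpty⇒increasing++nonincreasing (suc n) (C ∷ Bs) h dp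
... | U , D , eq , inc , n<U , ninc =
  n ∷ U , D , cong (n ∷_) eq , n<U ∷ inc , ≤-refl ∷ All.map <⇒≤ n<U , ninc

innerBlocksEmpty⇒smallerBeforeRise : ∀ {n Bs} → InnerBlocksEmpty Bs → All (DecPace d) (factors n Bs) →
  SmallerBeforeRise (concatL (factors n Bs))
innerBlocksEmpty⇒smallerBeforeRise {n = n} {Bs} empty dp
  with innerBlocksEmpty⇒increasing++nonincreasing n Bs empty dp
... | U , D , eq , inc , _ , ninc =
  subst SmallerBeforeRise (sym eq) (increasing++nonincreasing⇒smallerBeforeRise inc ninc)

Covers : ℕ → List ℕ → Set
Covers m X = ∀ {b} → 1 ≤ b → b ≤ m → b ∈ X

covers-zero : Covers 0 X
covers-zero 1≤b b≤0 = ⊥-elim (≤⇒≯ b≤0 1≤b)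

covers-snoc : Covers m X → Covers (suc m) (X ++ suc m ∷ [])
covers-snoc cov 1≤b b≤1+m with m≤n⇒m<n∨m≡n b≤1+m
... | inj₁ (s≤s b≤m) = ∈-++⁺ˡ (cov 1≤b b≤m)
... | inj₂ refl      = ∈-++⁺ʳ _ (here refl)

contains-112 : ∀ {Y} → b ∈ X → (b ∷ c ∷ []) ⊆ Y → b < c → Contains (X ++ Y) (1 ∷ 1 ∷ 2 ∷ [])
contains-112 b∈X sub b<c = _ , ++⁺ (from∈ b∈X) sub , 112-iso b<c

avoids-snoc : ∀ {p} Y → Avoids (X ++ a ∷ Y) p → Avoids ((X ++ a ∷ []) ++ Y) p
avoids-snoc {X} {a} {p} Y = subst (λ w → Avoids w p) (sym (∷ʳ-++ X a Y))

avoids-112⇒innerBlocksEmpty : ∀ Bs → Covers m X →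
  Avoids (X ++ concatL (factors (suc m) Bs)) (1 ∷ 1 ∷ 2 ∷ []) →
  All (1 ≤_) (concatL (factors (suc m) Bs)) → All (DecPace d) (factors (suc m) Bs) →
  InnerBlocksEmpty Bs
avoids-112⇒innerBlocksEmpty []            _   _  _   _ = []
avoids-112⇒innerBlocksEmpty (_ ∷ [])      _   _  _   _ = []
avoids-112⇒innerBlocksEmpty ([] ∷ C ∷ Bs) cov av (_ ∷ pos) (_ ∷ dp) =
  refl ∷ avoids-112⇒innerBlocksEmpty (C ∷ Bs) (covers-snoc cov) (avoids-snoc _ av) pos dp
avoids-112⇒innerBlocksEmpty ((b ∷ r) ∷ _ ∷ _) cov av (_ ∷ 1≤b ∷ _) (dp ∷ _)
  with DecPace⇒nonincreasing dp
... | b≤1+m ∷ _ =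
  ⊥-elim (avoids-snoc _ av
    (contains-112 (covers-snoc cov 1≤b b≤1+m) (refl ∷ ++⁺ˡ r (refl ∷ minimum _)) (s<s b≤1+m)))

lemma6p2 : (d : ℕ) (α : List ℕ) → InÃ d α →
    (Bs : List (List ℕ)) →
    α ≡ concatL (factors 1 Bs) →
    All (DecPace d) (factors 1 Bs) →
    length Bs ≡ maxW α →
    ((Avoids α (1 ∷ 1 ∷ 2 ∷ []) × Avoids α (2 ∷ 1 ∷ 3 ∷ []))
      ⇔ All (_≡ []) (take (length Bs ∸ 1) Bs))
lemma6p2 d α ((positive , _) , _) Bs refl dp _ = mk⇔
  (λ (avoids112 , _) → avoids-112⇒innerBlocksEmpty Bs covers-zero avoids112 positive dp)
  (λ empty → let smaller = innerBlocksEmpty⇒smallerBeforeRise empty dp in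
     SmallerBeforeRise⇒avoids smaller 112-shape , SmallerBeforeRise⇒avoids smaller 213-shape)
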